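{- Let $\Sigma^*$ be the structure of all nonempty finite strings over $\{a,b\}$ with $*$ interpreted as concatenation. For strings $x$, let $\alpha(x)$ and $\beta(x)$ be the number of occurrences of $a$, resp. $b$, in $x$. Say $x$ is almost even, $\mathcal{AE}(x)$, if $\alpha(x)=\beta(x)+1$ and for every proper initial segment $u$ of $x$ (i.e. $uBx$) we have $\alpha(u)\le\beta(u)$. Then, for all strings $x,x_2,y,u,v$: (a) if $\mathcal{AE}(x)$ then $x=a$ or ($bBx$ and $aaEx$); (b) if $\mathcal{AE}(x)$ and $x_2Ex$, then $\alpha(x_2)\ge\beta(x_2)+1$; (c) if $\mathcal{AE}(x)$, $\mathcal{AE}(u)$ and $x*y=u*v$, then $x=u$ and $y=v$.
   Context: $xBy$ means $\exists z\,(x*z=y)$ ($x$ is a proper initial segment of $y$); $xEy$ means $\exists z\,(z*x=y)$ ($x$ is a proper end segment of $y$). Strings are nonempty; $xy$ denotes $x*y$. -}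

module Defs where

open import Data.Nat using (ℕ; zero; suc; _+_; _≤_)
open import Data.List using (List; []; _∷_)
open import Data.List.NonEmpty using (List⁺; _∷_; [_]; _⁺++⁺_; toList)
open import Data.Product using (∃; _×_)
open import Relation.Binary.PropositionalEquality using (_≡_)

data Sym : Set where
  a b : Sym

Str : Set
Str = List⁺ Sym

infixr 5 _✶_
_✶_ : Str → Str → Str
x ✶ y = x ⁺++⁺ y

_B_ : Str → Str → Set
x B y = ∃ λ z → x ✶ z ≡ y

_E_ : Str → Str → Set
x E y = ∃ λ z → z ✶ x ≡ y

countA countB : List Sym → ℕ
countA [] = 0
countA (a ∷ s) = suc (countA s)
countA (b ∷ s) = countA s
countB [] = 0
countB (a ∷ s) = countB s
countB (b ∷ s) = suc (countB s)

α β : Str → ℕ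
α x = countA (toList x)
β x = countB (toList x)

sa sb saa : Str
sa = [ a ]
sb = [ b ]
saa = a ∷ a ∷ []

AE : Str → Set
AE x = (α x ≡ suc (β x)) × (∀ u → u B x → α u ≤ β u)

{-# OPTIONS --safe #-}
-- Call α − β the surplus of a word.  An almost even word has surplus one and
-- each proper prefix has surplus at most zero, so each proper suffix has positive
-- surplus: this is (b).  For (a), the suffix of length two has positive surplus,
-- so it is aa, and the first letter, being a proper prefix, is b.  For (c), no
-- almost even word is a proper prefix of another, while two factorisations
-- x y = u v either coincide or make one of x, u a proper prefix of the other.
module Submission where

open import Defs
open import Data.Nat using (_≥_; suc; _+_; _≤_; s≤s)
open import Data.Nat.Properties using (+-suc; +-cancelˡ-≤; +-monoˡ-≤; ≤-trans; ≤-reflexive; n≮n)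
open import Data.List using ([]; _∷_; _++_)
open import Data.List.NonEmpty using (_∷_; [_]; head; tail; snocView; _∷ʳ′_)
open import Data.List.NonEmpty.Properties using (⁺++⁺-assoc; ∷→∷⁺)
open import Data.Product using (_×_; _,_; ∃; ∃₂)
open import Data.Sum using (_⊎_; inj₁; inj₂)
open import Data.Empty using (⊥-elim)
open import Relation.Nullary using (¬_)
open import Relation.Binary.PropositionalEquality using (_≡_; refl; sym; trans; cong; subst)

countA-++ : ∀ l m → countA (l ++ m) ≡ countA l + countA m
countA-++ []      m = refl
countA-++ (a ∷ l) m = cong suc (countA-++ l m)
countA-++ (b ∷ l) m = countA-++ l m

countB-++ : ∀ l m → countB (l ++ m) ≡ countB l + countB m
countB-++ []      m = refl
countB-++ (a ∷ l) m = countB-++ l m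
countB-++ (b ∷ l) m = cong suc (countB-++ l m)

α-✶ : ∀ x y → α (x ✶ y) ≡ α x + α y
α-✶ (x ∷ xs) (y ∷ ys) = countA-++ (x ∷ xs) (y ∷ ys)

β-✶ : ∀ x y → β (x ✶ y) ≡ β x + β y
β-✶ (x ∷ xs) (y ∷ ys) = countB-++ (x ∷ xs) (y ∷ ys)

letter-or-snoc : (x : Str) → (∃ λ c → x ≡ [ c ]) ⊎ (∃₂ λ p c → x ≡ p ✶ [ c ])
letter-or-snoc x with snocView x
... | []       ∷ʳ′ c = inj₁ (c , refl)
... | (y ∷ ys) ∷ʳ′ c = inj₂ (y ∷ ys , c , refl)

letter-B : ∀ h t y → [ h ] B ((h ∷ t) ✶ y)
letter-B h []       y        = y , refl
letter-B h (c ∷ cs) (y ∷ ys) = (c ∷ cs) ✶ (y ∷ ys) , refl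

✶-equidivisible : ∀ x y u v → x ✶ y ≡ u ✶ v → (x ≡ u × y ≡ v) ⊎ (x B u ⊎ u B x)
✶-equidivisible (h ∷ t) y (h′ ∷ t′) v = split h t y h′ t′ v
  where
  split : ∀ h t y h′ t′ v → (h ∷ t) ✶ y ≡ (h′ ∷ t′) ✶ v →
          ((h ∷ t) ≡ (h′ ∷ t′) × y ≡ v) ⊎ ((h ∷ t) B (h′ ∷ t′) ⊎ (h′ ∷ t′) B (h ∷ t))
  split _ []       (_ ∷ _) _ []       (_ ∷ _) refl = inj₁ (refl , refl)
  split _ []       (_ ∷ _) _ (d ∷ ds) (_ ∷ _) refl = inj₂ (inj₁ (d ∷ ds , refl))
  split _ (c ∷ cs) (_ ∷ _) _ []       (_ ∷ _) refl = inj₂ (inj₂ (c ∷ cs , refl))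
  split h (c ∷ cs) (y ∷ ys) h′ (d ∷ ds) (v ∷ vs) e
    with cong head e | split c cs (y ∷ ys) d ds (v ∷ vs) (∷→∷⁺ (cong tail e))
  ... | refl | inj₁ (refl , y≡v)           = inj₁ (refl , y≡v)
  ... | refl | inj₂ (inj₁ (z ∷ zs , refl)) = inj₂ (inj₁ (z ∷ zs , refl))
  ... | refl | inj₂ (inj₂ (z ∷ zs , refl)) = inj₂ (inj₂ (z ∷ zs , refl))

surplus-of-suffix : ∀ {m n k l} → m ≤ n → m + k ≡ suc (n + l) → k ≥ suc l
surplus-of-suffix {m} {n} {k} {l} m≤n eq = +-cancelˡ-≤ n (suc l) k
  (≤-trans (≤-reflexive (trans (+-suc n l) (sym eq))) (+-monoˡ-≤ k m≤n))

AE-suffix-surplus : ∀ {x x₂} → AE x → x₂ E x → α x₂ ≥ suc (β x₂)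
AE-suffix-surplus {x₂ = x₂} (αx≡ , prefix-bound) (z , refl) =
  surplus-of-suffix (prefix-bound z (x₂ , refl))
    (trans (sym (α-✶ z x₂)) (trans αx≡ (cong suc (β-✶ z x₂))))

AE-not-B-AE : ∀ {x u} → AE x → AE u → ¬ x B u
AE-not-B-AE {x} (αx≡ , _) (_ , prefix-bound) x-B-u =
  n≮n (β x) (subst (_≤ β x) αx≡ (prefix-bound x x-B-u))

AE-letter : ∀ c → AE [ c ] → [ c ] ≡ sa
AE-letter a _ = refl
AE-letter b (() , _)

¬AE-two-letters : ∀ c′ c → ¬ AE ([ c′ ] ✶ [ c ])
¬AE-two-letters a a (() , _)
¬AE-two-letters a b (() , _)
¬AE-two-letters b a (() , _)
¬AE-two-letters b b (() , _)

surplus-two-letters : ∀ c′ c → α ([ c′ ] ✶ [ c ]) ≥ suc (β ([ c′ ] ✶ [ c ])) → c′ ≡ a × c ≡ a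
surplus-two-letters a a _        = refl , refl
surplus-two-letters a b (s≤s ())
surplus-two-letters b a (s≤s ())
surplus-two-letters b b ()

AE-starts-with-b : ∀ x y → AE (x ✶ y) → sb B (x ✶ y)
AE-starts-with-b (a ∷ t) y (_ , prefix-bound) with prefix-bound sa (letter-B a t y)
... | ()
AE-starts-with-b (b ∷ t) y _ = letter-B b t y

AE-ends-with-aa : ∀ q c′ c → AE ((q ✶ [ c′ ]) ✶ [ c ]) → saa E ((q ✶ [ c′ ]) ✶ [ c ])
AE-ends-with-aa q c′ c ae
  with surplus-two-letters c′ c (AE-suffix-surplus ae (q , sym (⁺++⁺-assoc q [ c′ ] [ c ])))
... | refl , refl = q , sym (⁺++⁺-assoc q sa sa)

AE-shape : ∀ x → AE x → (x ≡ sa) ⊎ ((sb B x) × (saa E x))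
AE-shape x ae with letter-or-snoc x
... | inj₁ (c , refl) = inj₁ (AE-letter c ae)
... | inj₂ (p , c , refl) with letter-or-snoc p
...   | inj₁ (c′ , refl)     = ⊥-elim (¬AE-two-letters c′ c ae)
...   | inj₂ (q , c′ , refl) = inj₂ (AE-starts-with-b (q ✶ [ c′ ]) [ c ] ae , AE-ends-with-aa q c′ c ae)

AE-factor-unique : ∀ {x y u v} → AE x → AE u → x ✶ y ≡ u ✶ v → (x ≡ u) × (y ≡ v)
AE-factor-unique {x} {y} {u} {v} ae-x ae-u e with ✶-equidivisible x y u v e
... | inj₁ x≡u×y≡v   = x≡u×y≡v
... | inj₂ (inj₁ xBu) = ⊥-elim (AE-not-B-AE ae-x ae-u xBu)
... | inj₂ (inj₂ uBx) = ⊥-elim (AE-not-B-AE ae-u ae-x uBx)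

mainTheorem2 : (x x₂ y u v : Str) →
    (AE x → (x ≡ sa) ⊎ ((sb B x) × (saa E x)))
    × (AE x → x₂ E x → α x₂ ≥ suc (β x₂))
    × (AE x → AE u → x ✶ y ≡ u ✶ v → (x ≡ u) × (y ≡ v))
mainTheorem2 x x₂ y u v = AE-shape x , AE-suffix-surplus , AE-factor-unique
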